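{- Let $d\ge 2$, $k\ge 1$ be integers, let $G$ be a $(d,k;+1)$-digraph whose outlier function has $w$ orbits, and let $\tilde A$ be the adjacency matrix of the orbital-connection pseudodigraph of $G$. Then $$\operatorname{tr}\bigl(\tilde A+\tilde A^2+\cdots+\tilde A^{\lfloor k/2\rfloor}\bigr)\le \lfloor k/2\rfloor\, w.$$
   Context: A digraph has no loops and no multiple arcs. $G$ is $k$-geodetic if for any $u,v$ there is at most one directed $u,v$-walk of length at most $k$. $M(d,k)=1+d+\cdots+d^k$. A $(d,k;+1)$-digraph is a $k$-geodetic digraph with minimum out-degree $d$ and order $M(d,k)+1$. In such a digraph every vertex has out-degree exactly $d$, and for each vertex $u$ there is a unique vertex $o(u)$ at distance greater than $k$ from $u$; the outlier function $o$ is a fixed-point-free digraph automorphism. Let its orbits be $\mathcal{O}_1,\dots,\mathcal{O}_w$. The orbital-connection pseudodigraph $\tilde G$ has vertex set $\{\mathcal{O}_1,\dots,\mathcal{O}_w\}$; choosing representatives $v(\mathcal{O}_i)\in\mathcal{O}_i$, the number of arcs (loops if $i=j$) from $\mathcal{O}_i$ to $\mathcal{O}_j$ is the number of arcs of $G$ from $v(\mathcal{O}_i)$ to vertices of $\mathcal{O}_j$ (independent of the choice of representatives). $\tilde A$ is the $w\times w$ matrix whose $(i,j)$ entry is this number. -}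

module Defs where

open import Data.Nat using (ℕ; zero; suc; _+_; _*_; _^_; _≤_)
open import Data.Fin using (Fin; zero; suc)
open import Data.Fin.Properties using (_≟_)
open import Data.Bool using (Bool; true; false; if_then_else_; _∧_)
open import Relation.Nullary.Decidable using (⌊_⌋)
open import Relation.Binary.PropositionalEquality using (_≡_)
open import Data.Product using (∃)
open import Function using (_∘_)

Σ[_] : (n : ℕ) → (Fin n → ℕ) → ℕ
Σ[ zero ] f = 0
Σ[ suc n ] f = f zero + Σ[ n ] (f ∘ suc)

Mat : ℕ → Set
Mat n = Fin n → Fin n → ℕ

_⊗_ : {n : ℕ} → Mat n → Mat n → Mat n
_⊗_ {n} A B i j = Σ[ n ] (λ l → A i l * B l j)

idM : {n : ℕ} → Mat n
idM i j = if ⌊ i ≟ j ⌋ then 1 else 0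

_^M_ : {n : ℕ} → Mat n → ℕ → Mat n
A ^M zero = idM
A ^M suc m = A ⊗ (A ^M m)

tr : {n : ℕ} → Mat n → ℕ
tr {n} A = Σ[ n ] (λ i → A i i)

powSum1 : {n : ℕ} → Mat n → ℕ → Mat n
powSum1 A zero i j = 0
powSum1 A (suc m) i j = powSum1 A m i j + (A ^M suc m) i j

-- A digraph on vertex set Fin n, given by its arc relation (so no multiple arcs)
Digraph : ℕ → Set
Digraph n = Fin n → Fin n → Bool

b2n : Bool → ℕ
b2n true = 1
b2n false = 0

adjMat : {n : ℕ} → Digraph n → Mat n
adjMat G u v = b2n (G u v)

Loopless : {n : ℕ} → Digraph n → Set
Loopless G = ∀ v → G v v ≡ false

outdeg : {n : ℕ} → Digraph n → Fin n → ℕ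
outdeg {n} G u = Σ[ n ] (λ v → b2n (G u v))

walksUpTo : {n : ℕ} → Digraph n → ℕ → Fin n → Fin n → ℕ
walksUpTo G zero u v = (adjMat G ^M zero) u v
walksUpTo G (suc k) u v = walksUpTo G k u v + (adjMat G ^M suc k) u v

KGeodetic : {n : ℕ} → Digraph n → ℕ → Set
KGeodetic G k = ∀ u v → walksUpTo G k u v ≤ 1

Moore : ℕ → ℕ → ℕ
Moore d zero = 1
Moore d (suc k) = Moore d k + d ^ suc k

IsDK1 : (d k n : ℕ) → Digraph n → Set
IsDK1 d k n G =
  Loopless G × KGeodetic G k × (∀ u → d ≤ outdeg G u) × (n ≡ suc (Moore d k))
  where open import Data.Product using (_×_)

FarFrom : {n : ℕ} → Digraph n → ℕ → Fin n → Fin n → Set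
FarFrom G k u v = walksUpTo G k u v ≡ 0

iter : {A : Set} → (A → A) → ℕ → A → A
iter f zero x = x
iter f (suc m) x = f (iter f m x)

OrbitLabelling : {n w : ℕ} → (Fin n → Fin n) → (Fin n → Fin w) → Set
OrbitLabelling {n} o orb =
  ∀ u v → (orb u ≡ orb v → ∃ λ m → iter o m u ≡ v) × (∃ (λ m → iter o m u ≡ v) → orb u ≡ orb v)
  where open import Data.Product using (_×_)

-- adjacency matrix of the orbital-connection pseudodigraph, using
-- representatives rep i ∈ orbit i:  entry (i,j) = #arcs from rep i into orbit j
orbMat : {n w : ℕ} → Digraph n → (Fin n → Fin w) → (Fin w → Fin n) → Mat w
orbMat {n} G orb rep i j = Σ[ n ] (λ v → b2n (G (rep i) v ∧ ⌊ orb v ≟ j ⌋))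

{-# OPTIONS --safe #-}
-- Let A be the adjacency matrix, W = I + A + ⋯ + Aᵏ and P the permutation matrix of o.
-- At least M(d,k) walks of length ≤ k leave each u, ending at distinct vertices other
-- than o(u); hence W + P = J and G is d-out-regular. As A commutes with W, comparing
-- A(W + P) = dJ with (W + P)A gives AP = PA: o is an automorphism, so the orbit
-- partition is equitable and Ãˡ(i,i) counts the ℓ-walks from a representative u of 𝒪ᵢ
-- that end in 𝒪ᵢ. Two of them ending at distinct x = oᵃu and y = oᵇu, together with
-- their images under oᵇ and oᵃ, would be two distinct 2ℓ-walks from u to oᵃy = oᵇx.
-- So for 2ℓ ≤ k every diagonal entry of Ãˡ is at most 1.
module Submission where

open import Defs
open import Data.Nat using (ℕ; zero; suc; _+_; _*_; _^_; _/_; _≤_; _≤?_; z≤n; s≤s; pred; >-nonZero; >-nonZero⁻¹)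
open import Data.Nat.Properties hiding (_≟_; suc-injective; 0≢1+n)
open import Data.Nat.DivMod using (m/n*n≤m)
open import Data.Fin using (Fin; zero; suc)
open import Data.Fin.Properties using (_≟_; suc-injective; 0≢1+n)
open import Data.Fin.Permutation using (Permutation′; permutation; _⟨$⟩ʳ_)
open import Data.Bool using (true; false; _∧_; if_then_else_)
open import Data.Product using (∃; _×_; _,_; proj₁; proj₂)
open import Data.Empty using (⊥-elim)
open import Data.Sum using (inj₁; inj₂)
open import Function using (_∘_)
open import Function.Bundles using (Injection)
open import Function.Definitions using (Injective)
open import Function.Properties.Inverse using (↔⇒↣)
open import Relation.Nullary using (yes; no)
open import Relation.Binary.PropositionalEquality
open import Algebra.Properties.Semiring.Sum +-*-semiring
  using (sum; sum-cong-≗; ∑-comm; ∑-distrib-+; *-distribˡ-sum; *-distribʳ-sum; sum-permute)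
open import Algebra.Properties.CommutativeSemigroup +-commutativeSemigroup
  using (xy∙z≈xz∙y; x∙yz≈yx∙z)

idM-diag : ∀ {n} (i : Fin n) → idM i i ≡ 1
idM-diag i with i ≟ i
... | yes _   = refl
... | no i≢i = ⊥-elim (i≢i refl)

idM-off : ∀ {n} {i j : Fin n} → i ≢ j → idM i j ≡ 0
idM-off {i = i} {j} i≢j with i ≟ j
... | yes i≡j = ⊥-elim (i≢j i≡j)
... | no _    = refl

idM-≤1 : ∀ {n} (i j : Fin n) → idM i j ≤ 1
idM-≤1 i j with i ≟ j
... | yes _ = ≤-refl
... | no _  = z≤n

idM-pos⇒≡ : ∀ {n} {i j : Fin n} → 1 ≤ idM i j → i ≡ j
idM-pos⇒≡ {i = i} {j} pos with i ≟ j
idM-pos⇒≡ _  | yes i≡j = i≡j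
idM-pos⇒≡ () | no _

idM-sym : ∀ {n} (i j : Fin n) → idM i j ≡ idM j i
idM-sym i j with i ≟ j
... | yes refl = sym (idM-diag i)
... | no i≢j   = sym (idM-off (i≢j ∘ sym))

idM-injective : ∀ {m n} {f : Fin m → Fin n} → Injective _≡_ _≡_ f → ∀ i j → idM (f i) (f j) ≡ idM i j
idM-injective {f = f} f-inj i j with i ≟ j
... | yes refl = idM-diag (f i)
... | no i≢j   = idM-off (i≢j ∘ f-inj)

Σ≡sum : ∀ n (f : Fin n → ℕ) → Σ[ n ] f ≡ sum f
Σ≡sum zero    f = refl
Σ≡sum (suc n) f = cong (f zero +_) (Σ≡sum n (f ∘ suc))

Σ-cong : ∀ n {f g : Fin n → ℕ} → (∀ i → f i ≡ g i) → Σ[ n ] f ≡ Σ[ n ] g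
Σ-cong zero    f≗g = refl
Σ-cong (suc n) f≗g = cong₂ _+_ (f≗g zero) (Σ-cong n (f≗g ∘ suc))

Σ-const : ∀ n c → Σ[ n ] (λ _ → c) ≡ n * c
Σ-const zero    c = refl
Σ-const (suc n) c = cong (c +_) (Σ-const n c)

Σ-zero : ∀ n → Σ[ n ] (λ _ → 0) ≡ 0
Σ-zero n = trans (Σ-const n 0) (*-zeroʳ n)

Σ-distrib-+ : ∀ n (f g : Fin n → ℕ) → Σ[ n ] (λ i → f i + g i) ≡ Σ[ n ] f + Σ[ n ] g
Σ-distrib-+ n f g = begin
  Σ[ n ] (λ i → f i + g i)  ≡⟨ Σ≡sum n _ ⟩
  sum (λ i → f i + g i)     ≡⟨ ∑-distrib-+ f g ⟩
  sum f + sum g             ≡⟨ sym (cong₂ _+_ (Σ≡sum n f) (Σ≡sum n g)) ⟩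
  Σ[ n ] f + Σ[ n ] g       ∎
  where open ≡-Reasoning

*-distribˡ-Σ : ∀ n c (f : Fin n → ℕ) → c * Σ[ n ] f ≡ Σ[ n ] (λ i → c * f i)
*-distribˡ-Σ n c f = begin
  c * Σ[ n ] f             ≡⟨ cong (c *_) (Σ≡sum n f) ⟩
  c * sum f                ≡⟨ *-distribˡ-sum c f ⟩
  sum (λ i → c * f i)      ≡⟨ sym (Σ≡sum n _) ⟩
  Σ[ n ] (λ i → c * f i)   ∎
  where open ≡-Reasoning

*-distribʳ-Σ : ∀ n c (f : Fin n → ℕ) → Σ[ n ] f * c ≡ Σ[ n ] (λ i → f i * c)
*-distribʳ-Σ n c f = begin
  Σ[ n ] f * c             ≡⟨ cong (_* c) (Σ≡sum n f) ⟩
  sum f * c                ≡⟨ *-distribʳ-sum c f ⟩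
  sum (λ i → f i * c)      ≡⟨ sym (Σ≡sum n _) ⟩
  Σ[ n ] (λ i → f i * c)   ∎
  where open ≡-Reasoning

Σ-comm : ∀ m n (f : Fin m → Fin n → ℕ) →
         Σ[ m ] (λ i → Σ[ n ] (f i)) ≡ Σ[ n ] (λ j → Σ[ m ] (λ i → f i j))
Σ-comm m n f = begin
  Σ[ m ] (λ i → Σ[ n ] (f i))              ≡⟨ Σ²≡sum² m n f ⟩
  sum (λ i → sum (f i))                    ≡⟨ ∑-comm f ⟩
  sum (λ j → sum (λ i → f i j))            ≡⟨ sym (Σ²≡sum² n m (λ j i → f i j)) ⟩
  Σ[ n ] (λ j → Σ[ m ] (λ i → f i j))      ∎
  where
  open ≡-Reasoning
  Σ²≡sum² : ∀ m n (g : Fin m → Fin n → ℕ) → Σ[ m ] (λ i → Σ[ n ] (g i)) ≡ sum (λ i → sum (g i))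
  Σ²≡sum² m n g = trans (Σ≡sum m _) (sum-cong-≗ (λ i → Σ≡sum n (g i)))

Σ-permute : ∀ n (π : Permutation′ n) (f : Fin n → ℕ) → Σ[ n ] (f ∘ (π ⟨$⟩ʳ_)) ≡ Σ[ n ] f
Σ-permute n π f = begin
  Σ[ n ] (f ∘ (π ⟨$⟩ʳ_))   ≡⟨ Σ≡sum n _ ⟩
  sum (f ∘ (π ⟨$⟩ʳ_))      ≡⟨ sym (sum-permute f π) ⟩
  sum f                    ≡⟨ sym (Σ≡sum n f) ⟩
  Σ[ n ] f                 ∎
  where open ≡-Reasoning

Σ-δˡ : ∀ n (i : Fin n) (f : Fin n → ℕ) → Σ[ n ] (λ l → idM i l * f l) ≡ f i
Σ-δˡ (suc n) zero f = begin
  f zero + 0 + Σ[ n ] (λ _ → 0)  ≡⟨ cong₂ _+_ (+-identityʳ (f zero)) (Σ-zero n) ⟩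
  f zero + 0                     ≡⟨ +-identityʳ (f zero) ⟩
  f zero                         ∎
  where open ≡-Reasoning
Σ-δˡ (suc n) (suc i) f =
  trans (Σ-cong n (λ l → cong (_* f (suc l)) (idM-injective suc-injective i l))) (Σ-δˡ n i (f ∘ suc))

Σ-δʳ : ∀ n (i : Fin n) (f : Fin n → ℕ) → Σ[ n ] (λ l → f l * idM l i) ≡ f i
Σ-δʳ n i f = trans (Σ-cong n (λ l → trans (*-comm (f l) _) (cong (_* f l) (idM-sym l i)))) (Σ-δˡ n i f)

Σ-δ : ∀ n (i : Fin n) → Σ[ n ] (idM i) ≡ 1
Σ-δ n i = trans (Σ-cong n (λ l → sym (*-identityʳ (idM i l)))) (Σ-δˡ n i (λ _ → 1))

Σ-*-assoc : ∀ m n (f : Fin m → ℕ) (g : Fin m → Fin n → ℕ) (h : Fin n → ℕ) →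
            Σ[ n ] (λ v → Σ[ m ] (λ l → f l * g l v) * h v) ≡ Σ[ m ] (λ l → f l * Σ[ n ] (λ v → g l v * h v))
Σ-*-assoc m n f g h = begin
  Σ[ n ] (λ v → Σ[ m ] (λ l → f l * g l v) * h v)    ≡⟨ Σ-cong n (λ v → *-distribʳ-Σ m (h v) _) ⟩
  Σ[ n ] (λ v → Σ[ m ] (λ l → f l * g l v * h v))    ≡⟨ Σ-comm n m _ ⟩
  Σ[ m ] (λ l → Σ[ n ] (λ v → f l * g l v * h v))    ≡⟨ Σ-cong m (λ l → Σ-cong n (λ v → *-assoc (f l) _ _)) ⟩
  Σ[ m ] (λ l → Σ[ n ] (λ v → f l * (g l v * h v)))  ≡⟨ Σ-cong m (λ l → sym (*-distribˡ-Σ n (f l) _)) ⟩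
  Σ[ m ] (λ l → f l * Σ[ n ] (λ v → g l v * h v))    ∎
  where open ≡-Reasoning

Σ-mono-≤ : ∀ n {f g : Fin n → ℕ} → (∀ i → f i ≤ g i) → Σ[ n ] f ≤ Σ[ n ] g
Σ-mono-≤ zero    f≤g = z≤n
Σ-mono-≤ (suc n) f≤g = +-mono-≤ (f≤g zero) (Σ-mono-≤ n (f≤g ∘ suc))

≤-Σ : ∀ n (f : Fin n → ℕ) i → f i ≤ Σ[ n ] f
≤-Σ (suc n) f zero    = m≤m+n _ _
≤-Σ (suc n) f (suc i) = ≤-trans (≤-Σ n (f ∘ suc) i) (m≤n+m _ _)

+-≤-Σ : ∀ n (f : Fin n → ℕ) {i j} → i ≢ j → f i + f j ≤ Σ[ n ] f
+-≤-Σ (suc n) f {zero}  {zero}  0≢0 = ⊥-elim (0≢0 refl)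
+-≤-Σ (suc n) f {zero}  {suc j} _   = +-monoʳ-≤ (f zero) (≤-Σ n (f ∘ suc) j)
+-≤-Σ (suc n) f {suc i} {zero}  _   = subst (_≤ Σ[ suc n ] f) (+-comm (f zero) _) (+-monoʳ-≤ (f zero) (≤-Σ n (f ∘ suc) i))
+-≤-Σ (suc n) f {suc i} {suc j} i≢j = ≤-trans (+-≤-Σ n (f ∘ suc) (i≢j ∘ cong suc)) (m≤n+m _ _)

Σ-≤1 : ∀ n (f : Fin n → ℕ) → (∀ i → f i ≤ 1) → (∀ i j → 1 ≤ f i → 1 ≤ f j → i ≡ j) → Σ[ n ] f ≤ 1
Σ-≤1 zero    f f≤1 unique = z≤n
Σ-≤1 (suc n) f f≤1 unique with 1 ≤? f zero
... | no f₀≱1 = begin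
  f zero + Σ[ n ] (f ∘ suc)  ≡⟨ cong (_+ Σ[ n ] (f ∘ suc)) (n<1⇒n≡0 (≰⇒> f₀≱1)) ⟩
  Σ[ n ] (f ∘ suc)           ≤⟨ Σ-≤1 n (f ∘ suc) (f≤1 ∘ suc) (λ i j fi fj → suc-injective (unique (suc i) (suc j) fi fj)) ⟩
  1                          ∎
  where open ≤-Reasoning
... | yes f₀≥1 = begin
  f zero + Σ[ n ] (f ∘ suc)  ≡⟨ cong (f zero +_) rest≡0 ⟩
  f zero + 0                 ≡⟨ +-identityʳ (f zero) ⟩
  f zero                     ≤⟨ f≤1 zero ⟩
  1                          ∎
  where
  open ≤-Reasoning
  rest≡0 : Σ[ n ] (f ∘ suc) ≡ 0
  rest≡0 = trans (Σ-cong n (λ i → n<1⇒n≡0 (≰⇒> (0≢1+n ∘ unique zero (suc i) f₀≥1)))) (Σ-zero n)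

Σ-≥⇒pointwise-≡ : ∀ n {f g : Fin n → ℕ} → (∀ i → f i ≤ g i) → Σ[ n ] g ≤ Σ[ n ] f → ∀ i → f i ≡ g i
Σ-≥⇒pointwise-≡ (suc n) {f} {g} f≤g Σg≤Σf zero = ≤-antisym (f≤g zero)
  (+-cancelʳ-≤ _ _ _ (≤-trans Σg≤Σf (+-monoʳ-≤ (f zero) (Σ-mono-≤ n (f≤g ∘ suc)))))
Σ-≥⇒pointwise-≡ (suc n) {f} {g} f≤g Σg≤Σf (suc i) = Σ-≥⇒pointwise-≡ n (f≤g ∘ suc)
  (+-cancelˡ-≤ (g zero) _ _ (≤-trans Σg≤Σf (+-monoˡ-≤ _ (f≤g zero)))) i

module _ {n : ℕ} where

  infix 4 _≈M_
  _≈M_ : Mat n → Mat n → Set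
  A ≈M B = ∀ i j → A i j ≡ B i j

  _+M_ : Mat n → Mat n → Mat n
  (A +M B) i j = A i j + B i j

  rowSum : Mat n → Fin n → ℕ
  rowSum A u = Σ[ n ] (A u)

  ⊗-assoc : (A B C : Mat n) → (A ⊗ B) ⊗ C ≈M A ⊗ (B ⊗ C)
  ⊗-assoc A B C i j = Σ-*-assoc n n (A i) B (λ m → C m j)

  ⊗-identityˡ : (A : Mat n) → idM ⊗ A ≈M A
  ⊗-identityˡ A i j = Σ-δˡ n i (λ l → A l j)

  ⊗-identityʳ : (A : Mat n) → A ⊗ idM ≈M A
  ⊗-identityʳ A i j = Σ-δʳ n j (A i)

  ⊗-congˡ : (A : Mat n) {B C : Mat n} → B ≈M C → A ⊗ B ≈M A ⊗ C
  ⊗-congˡ A B≈C i j = Σ-cong n (λ l → cong (A i l *_) (B≈C l j))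

  ⊗-distribˡ-+M : (A B C : Mat n) → A ⊗ (B +M C) ≈M (A ⊗ B) +M (A ⊗ C)
  ⊗-distribˡ-+M A B C i j = trans (Σ-cong n (λ l → *-distribˡ-+ (A i l) (B l j) (C l j))) (Σ-distrib-+ n _ _)

  ⊗-distribʳ-+M : (A B C : Mat n) → (B +M C) ⊗ A ≈M (B ⊗ A) +M (C ⊗ A)
  ⊗-distribʳ-+M A B C i j = trans (Σ-cong n (λ l → *-distribʳ-+ (A l j) (B i l) (C i l))) (Σ-distrib-+ n _ _)

  ^M-+ : (A : Mat n) (a b : ℕ) → A ^M (a + b) ≈M (A ^M a) ⊗ (A ^M b)
  ^M-+ A zero    b i j = sym (⊗-identityˡ (A ^M b) i j)
  ^M-+ A (suc a) b i j = trans (⊗-congˡ A (^M-+ A a b) i j) (sym (⊗-assoc A (A ^M a) (A ^M b) i j))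

  ^M-comm : (A : Mat n) (ℓ : ℕ) → A ⊗ (A ^M ℓ) ≈M (A ^M ℓ) ⊗ A
  ^M-comm A zero    i j = trans (⊗-identityʳ A i j) (sym (⊗-identityˡ A i j))
  ^M-comm A (suc ℓ) i j = trans (⊗-congˡ A (^M-comm A ℓ) i j) (sym (⊗-assoc A (A ^M ℓ) A i j))

  rowSum-idM : ∀ u → rowSum idM u ≡ 1
  rowSum-idM u = Σ-δ n u

  rowSum-⊗ : (A B : Mat n) → ∀ u → rowSum (A ⊗ B) u ≡ Σ[ n ] (λ l → A u l * rowSum B l)
  rowSum-⊗ A B u = trans (Σ-comm n n (λ v l → A u l * B l v)) (Σ-cong n (λ l → sym (*-distribˡ-Σ n (A u l) (B l))))

  rowSum-^M-≥ : (A : Mat n) {d : ℕ} → (∀ u → d ≤ rowSum A u) → ∀ ℓ u → d ^ ℓ ≤ rowSum (A ^M ℓ) u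
  rowSum-^M-≥ A {d} d≤rowSum zero    u = ≤-reflexive (sym (rowSum-idM u))
  rowSum-^M-≥ A {d} d≤rowSum (suc ℓ) u = begin
    d * d ^ ℓ                                 ≤⟨ *-monoˡ-≤ (d ^ ℓ) (d≤rowSum u) ⟩
    rowSum A u * d ^ ℓ                        ≡⟨ *-distribʳ-Σ n (d ^ ℓ) (A u) ⟩
    Σ[ n ] (λ l → A u l * d ^ ℓ)              ≤⟨ Σ-mono-≤ n (λ l → *-monoʳ-≤ (A u l) (rowSum-^M-≥ A d≤rowSum ℓ l)) ⟩
    Σ[ n ] (λ l → A u l * rowSum (A ^M ℓ) l)  ≡⟨ sym (rowSum-⊗ A (A ^M ℓ) u) ⟩
    rowSum (A ^M suc ℓ) u                     ∎
    where open ≤-Reasoning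

module _ {n : ℕ} (G : Digraph n) where

  private
    A : Mat n
    A = adjMat G

  walksUpTo-comm : ∀ k → A ⊗ walksUpTo G k ≈M walksUpTo G k ⊗ A
  walksUpTo-comm zero      = ^M-comm A zero
  walksUpTo-comm (suc k) i j = begin
    (A ⊗ walksUpTo G (suc k)) i j                             ≡⟨ ⊗-distribˡ-+M A (walksUpTo G k) (A ^M suc k) i j ⟩
    (A ⊗ walksUpTo G k) i j + (A ⊗ (A ^M suc k)) i j          ≡⟨ cong₂ _+_ (walksUpTo-comm k i j) (^M-comm A (suc k) i j) ⟩
    (walksUpTo G k ⊗ A) i j + ((A ^M suc k) ⊗ A) i j          ≡⟨ sym (⊗-distribʳ-+M A (walksUpTo G k) (A ^M suc k) i j) ⟩
    (walksUpTo G (suc k) ⊗ A) i j                             ∎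
    where open ≡-Reasoning

  ^M≤walksUpTo : ∀ {ℓ k} → ℓ ≤ k → ∀ u v → (A ^M ℓ) u v ≤ walksUpTo G k u v
  ^M≤walksUpTo {k = zero}  z≤n u v = ≤-refl
  ^M≤walksUpTo {k = suc k} ℓ≤1+k u v with m≤n⇒m<n∨m≡n ℓ≤1+k
  ... | inj₁ (s≤s ℓ≤k) = ≤-trans (^M≤walksUpTo ℓ≤k u v) (m≤m+n _ _)
  ... | inj₂ refl      = m≤n+m _ _

  -- Only the first layer is counted by the actual out-degree, so that this bound also yields outdeg u ≤ d.
  Moore+outdeg≤rowSum : ∀ {d} → (∀ u → d ≤ outdeg G u) →
                        ∀ {k} → 1 ≤ k → ∀ u → Moore d k + outdeg G u ≤ rowSum (walksUpTo G k) u + d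
  Moore+outdeg≤rowSum {d} _ {suc zero} _ u = ≤-reflexive (begin
    1 + d * 1 + outdeg G u               ≡⟨ cong (λ x → 1 + x + outdeg G u) (*-identityʳ d) ⟩
    1 + d + outdeg G u                   ≡⟨ xy∙z≈xz∙y 1 d (outdeg G u) ⟩
    1 + outdeg G u + d                   ≡⟨ cong₂ (λ x y → x + y + d) (rowSum-idM u) (Σ-cong n (⊗-identityʳ A u)) ⟨
    rowSum idM u + rowSum (A ^M 1) u + d ≡⟨ cong (_+ d) (Σ-distrib-+ n (idM u) ((A ^M 1) u)) ⟨
    rowSum (walksUpTo G 1) u + d         ∎)
    where open ≡-Reasoning
  Moore+outdeg≤rowSum {d} d≤outdeg {suc (suc k)} _ u = begin
    Moore d (suc k) + d ^ suc (suc k) + outdeg G u   ≡⟨ xy∙z≈xz∙y (Moore d (suc k)) _ _ ⟩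
    Moore d (suc k) + outdeg G u + d ^ suc (suc k)   ≤⟨ +-mono-≤ (Moore+outdeg≤rowSum d≤outdeg {suc k} (s≤s z≤n) u)
                                                                  (rowSum-^M-≥ A d≤outdeg (suc (suc k)) u) ⟩
    rowSum W u + d + rowSum (A ^M suc (suc k)) u     ≡⟨ xy∙z≈xz∙y (rowSum W u) d _ ⟩
    rowSum W u + rowSum (A ^M suc (suc k)) u + d     ≡⟨ cong (_+ d) (Σ-distrib-+ n (W u) ((A ^M suc (suc k)) u)) ⟨
    rowSum (walksUpTo G (suc (suc k))) u + d         ∎
    where
    open ≤-Reasoning
    W = walksUpTo G (suc k)

module _ {A : Set} (f : A → A) where

  iter-+ : ∀ m p x → iter f (m + p) x ≡ iter f m (iter f p x)
  iter-+ zero    p x = refl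
  iter-+ (suc m) p x = cong f (iter-+ m p x)

  iter-sucʳ : ∀ m x → iter f (suc m) x ≡ iter f m (f x)
  iter-sucʳ zero    x = refl
  iter-sucʳ (suc m) x = cong f (iter-sucʳ m x)

  iter-comm : ∀ a b x → iter f a (iter f b x) ≡ iter f b (iter f a x)
  iter-comm a b x = trans (sym (iter-+ a b x)) (trans (cong (λ m → iter f m x) (+-comm a b)) (iter-+ b a x))

  iter-*-periodic : ∀ {p x} → iter f p x ≡ x → ∀ t → iter f (t * p) x ≡ x
  iter-*-periodic         fᵖx≡x zero    = refl
  iter-*-periodic {p} {x} fᵖx≡x (suc t) = trans (iter-+ p (t * p) x) (trans (cong (iter f p) (iter-*-periodic fᵖx≡x t)) fᵖx≡x)

  Periodic : Set
  Periodic = ∀ x → ∃ λ p → iter f (suc p) x ≡ x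

  periodic⇒injective : Periodic → Injective _≡_ _≡_ f
  periodic⇒injective periodic {a} {b} fa≡fb with periodic a | periodic b
  ... | p , fᵖ⁺¹a≡a | q , fᵠ⁺¹b≡b = begin
    a                              ≡⟨ iter-*-periodic {suc p} fᵖ⁺¹a≡a (suc q) ⟨
    iter f (suc q * suc p) a       ≡⟨ cong (λ m → iter f m a) (*-comm (suc q) (suc p)) ⟩
    iter f (suc r) a               ≡⟨ iter-sucʳ r a ⟩
    iter f r (f a)                 ≡⟨ cong (iter f r) fa≡fb ⟩
    iter f r (f b)                 ≡⟨ iter-sucʳ r b ⟨
    iter f (suc p * suc q) b       ≡⟨ iter-*-periodic {suc q} fᵠ⁺¹b≡b (suc p) ⟩
    b                              ∎
    where
    open ≡-Reasoning
    -- suc p * suc q computes to suc r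
    r = q + p * suc q

module _ {n : ℕ} where

  periodic⇒permutation : (f : Fin n → Fin n) → Periodic f → Permutation′ n
  periodic⇒permutation f periodic = permutation f f⁻¹ (λ y → proj₂ (periodic y)) (λ x → f-injective (proj₂ (periodic (f x))))
    where
    f⁻¹ : Fin n → Fin n
    f⁻¹ y = iter f (proj₁ (periodic y)) y
    f-injective : Injective _≡_ _≡_ f
    f-injective = periodic⇒injective f periodic

  Preserves : (Fin n → Fin n) → Mat n → Set
  Preserves f B = ∀ u v → B (f u) (f v) ≡ B u v

  iter-preserves : ∀ {f B} → Preserves f B → ∀ m → Preserves (iter f m) B
  iter-preserves f-pres zero    u v = refl
  iter-preserves f-pres (suc m) u v = trans (f-pres _ _) (iter-preserves f-pres m u v)

  ^M-preserves : ∀ (π : Permutation′ n) {A} → Preserves (π ⟨$⟩ʳ_) A → ∀ ℓ → Preserves (π ⟨$⟩ʳ_) (A ^M ℓ)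
  ^M-preserves π A-pres zero    = idM-injective (Injection.injective (↔⇒↣ π))
  ^M-preserves π {A} A-pres (suc ℓ) u v = begin
    Σ[ n ] (λ l → A (π ⟨$⟩ʳ u) l * (A ^M ℓ) l (π ⟨$⟩ʳ v))                         ≡⟨ Σ-permute n π _ ⟨
    Σ[ n ] (λ l → A (π ⟨$⟩ʳ u) (π ⟨$⟩ʳ l) * (A ^M ℓ) (π ⟨$⟩ʳ l) (π ⟨$⟩ʳ v))       ≡⟨ Σ-cong n (λ l → cong₂ _*_ (A-pres u l) (^M-preserves π A-pres ℓ l v)) ⟩
    Σ[ n ] (λ l → A u l * (A ^M ℓ) l v)                                           ∎
    where open ≡-Reasoning

*-pos⇒pos : ∀ m n → 1 ≤ m * n → 1 ≤ m × 1 ≤ n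
*-pos⇒pos m n mn>0 =
  >-nonZero⁻¹ m {{m*n≢0⇒m≢0 m {{>-nonZero mn>0}}}} , >-nonZero⁻¹ n {{m*n≢0⇒n≢0 m {{>-nonZero mn>0}}}}

⊗-≥2 : ∀ {n} (B C : Mat n) {u x y z} → x ≢ y →
       1 ≤ B u x → 1 ≤ C x z → 1 ≤ B u y → 1 ≤ C y z → 2 ≤ (B ⊗ C) u z
⊗-≥2 {n} B C {u} {z = z} x≢y Bux Cxz Buy Cyz =
  ≤-trans (+-mono-≤ (*-mono-≤ Bux Cxz) (*-mono-≤ Buy Cyz)) (+-≤-Σ n (λ l → B u l * C l z) x≢y)

module _ {n w : ℕ} (orb : Fin n → Fin w) where

  classSum : Mat n → Fin n → Fin w → ℕ
  classSum B x j = Σ[ n ] (λ v → B x v * idM (orb v) j)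

  classSum-^M : (A : Mat n) (Q : Mat w) → (∀ x j → classSum A x j ≡ Q (orb x) j) →
                ∀ ℓ x j → classSum (A ^M ℓ) x j ≡ (Q ^M ℓ) (orb x) j
  classSum-^M A Q equitable zero    x j = Σ-δˡ n x (λ v → idM (orb v) j)
  classSum-^M A Q equitable (suc ℓ) x j = begin
    Σ[ n ] (λ v → Σ[ n ] (λ l → A x l * (A ^M ℓ) l v) * idM (orb v) j) ≡⟨ Σ-*-assoc n n (A x) (A ^M ℓ) _ ⟩
    Σ[ n ] (λ l → A x l * classSum (A ^M ℓ) l j)                        ≡⟨ Σ-cong n (λ l → cong (A x l *_) (classSum-^M A Q equitable ℓ l j)) ⟩
    Σ[ n ] (λ l → A x l * (Q ^M ℓ) (orb l) j)                           ≡⟨ Σ-cong n (λ l → cong (A x l *_) (Σ-δˡ w (orb l) (λ m → (Q ^M ℓ) m j))) ⟨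
    Σ[ n ] (λ l → A x l * Σ[ w ] (λ m → idM (orb l) m * (Q ^M ℓ) m j))  ≡⟨ Σ-*-assoc n w (A x) (λ l m → idM (orb l) m) _ ⟨
    Σ[ w ] (λ m → classSum A x m * (Q ^M ℓ) m j)                        ≡⟨ Σ-cong w (λ m → cong (_* (Q ^M ℓ) m j) (equitable x m)) ⟩
    Σ[ w ] (λ m → Q (orb x) m * (Q ^M ℓ) m j)                           ∎
    where open ≡-Reasoning

  classSum-preserved : (π : Permutation′ n) → (∀ v → orb (π ⟨$⟩ʳ v) ≡ orb v) →
                       ∀ {B} → Preserves (π ⟨$⟩ʳ_) B → ∀ x j → classSum B (π ⟨$⟩ʳ x) j ≡ classSum B x j
  classSum-preserved π orb-π B-pres x j =
    trans (sym (Σ-permute n π _)) (Σ-cong n (λ v → cong₂ _*_ (B-pres x v) (cong (λ i → idM i j) (orb-π v))))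

module _ {n w : ℕ} {o : Fin n → Fin n} {orb : Fin n → Fin w} (labelling : OrbitLabelling o orb) where

  orb-o : ∀ x → orb (o x) ≡ orb x
  orb-o x = sym (proj₂ (labelling x (o x)) (1 , refl))

  orbit-periodic : Periodic o
  orbit-periodic x with proj₁ (labelling (o x) x) (orb-o x)
  ... | m , oᵐox≡x = m , trans (iter-sucʳ o m x) oᵐox≡x

  orbit-permutation : Permutation′ n
  orbit-permutation = periodic⇒permutation o orbit-periodic

  sameOrbit⇒iter : ∀ {x y} → orb x ≡ orb y → ∃ λ m → iter o m x ≡ y
  sameOrbit⇒iter {x} {y} = proj₁ (labelling x y)

  classSum-orbit-invariant : ∀ {B} → Preserves o B → ∀ {x y} → orb x ≡ orb y → ∀ j → classSum orb B x j ≡ classSum orb B y j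
  classSum-orbit-invariant {B} B-pres {x} x~y j with sameOrbit⇒iter x~y
  ... | m , refl = sym (classSum-iter m)
    where
    classSum-iter : ∀ m → classSum orb B (iter o m x) j ≡ classSum orb B x j
    classSum-iter zero    = refl
    classSum-iter (suc m) = trans (classSum-preserved orb orbit-permutation orb-o B-pres _ j) (classSum-iter m)

  classSum-diag-≤1 : ∀ {B} → Preserves o B → (∀ u v → B u v ≤ 1) → (∀ u z → (B ⊗ B) u z ≤ 1) →
                     ∀ u → classSum orb B u (orb u) ≤ 1
  classSum-diag-≤1 {B} B-pres B≤1 B²≤1 u = Σ-≤1 n _ (λ v → *-mono-≤ (B≤1 u v) (idM-≤1 (orb v) (orb u))) unique
    where
    Bᵐ-pres : ∀ m → Preserves (iter o m) B
    Bᵐ-pres = iter-preserves B-pres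
    unique : ∀ x y → 1 ≤ B u x * idM (orb x) (orb u) → 1 ≤ B u y * idM (orb y) (orb u) → x ≡ y
    unique x y ux uy with *-pos⇒pos (B u x) _ ux | *-pos⇒pos (B u y) _ uy
    ... | Bux , x~u | Buy , y~u with sameOrbit⇒iter {u} {x} (sym (idM-pos⇒≡ x~u)) | sameOrbit⇒iter {u} {y} (sym (idM-pos⇒≡ y~u))
    ... | a , refl | b , refl with iter o a u ≟ iter o b u
    ... | yes x≡y = x≡y
    ... | no x≢y = ⊥-elim (≤⇒≯ (B²≤1 u z) (⊗-≥2 B B x≢y Bux Bxz Buy Byz))
      where
      z = iter o a (iter o b u)
      Bxz : 1 ≤ B (iter o a u) z
      Bxz = subst (1 ≤_) (sym (Bᵐ-pres a u (iter o b u))) Buy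
      Byz : 1 ≤ B (iter o b u) z
      Byz = subst (λ t → 1 ≤ B (iter o b u) t) (iter-comm o b a u) (subst (1 ≤_) (sym (Bᵐ-pres b u (iter o a u))) Bux)

module Outlier {d k n : ℕ} {G : Digraph n} (k≥1 : 1 ≤ k) (geodetic : KGeodetic G k)
               (outdeg≥d : ∀ u → d ≤ outdeg G u) (order : n ≡ suc (Moore d k))
               {o : Fin n → Fin n} (far : ∀ u → FarFrom G k u (o u)) where

  private
    A W P : Mat n
    A = adjMat G
    W = walksUpTo G k
    P u x = idM (o u) x

  Moore≤rowSum : ∀ u → Moore d k ≤ rowSum W u
  Moore≤rowSum u = +-cancelʳ-≤ d _ _
    (≤-trans (+-monoʳ-≤ (Moore d k) (outdeg≥d u)) (Moore+outdeg≤rowSum G outdeg≥d k≥1 u))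

  rowSum-W+P : ∀ u → rowSum (W +M P) u ≡ suc (rowSum W u)
  rowSum-W+P u = trans (Σ-distrib-+ n (W u) (P u)) (trans (cong (rowSum W u +_) (Σ-δ n (o u))) (+-comm _ 1))

  W+P≤1 : ∀ u x → (W +M P) u x ≤ 1
  W+P≤1 u x with o u ≟ x
  ... | yes refl = ≤-reflexive (cong (_+ 1) (far u))
  ... | no _     = ≤-trans (≤-reflexive (+-identityʳ (W u x))) (geodetic u x)

  W+P≡1 : ∀ u x → (W +M P) u x ≡ 1
  W+P≡1 u = Σ-≥⇒pointwise-≡ n (W+P≤1 u) (begin
    Σ[ n ] (λ _ → 1)     ≡⟨ trans (Σ-const n 1) (*-identityʳ n) ⟩
    n                    ≡⟨ order ⟩
    suc (Moore d k)      ≤⟨ s≤s (Moore≤rowSum u) ⟩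
    suc (rowSum W u)     ≡⟨ rowSum-W+P u ⟨
    rowSum (W +M P) u    ∎)
    where open ≤-Reasoning

  rowSum≡Moore : ∀ u → rowSum W u ≡ Moore d k
  rowSum≡Moore u = cong pred (begin
    suc (rowSum W u)     ≡⟨ rowSum-W+P u ⟨
    rowSum (W +M P) u    ≡⟨ Σ-cong n (W+P≡1 u) ⟩
    Σ[ n ] (λ _ → 1)     ≡⟨ trans (Σ-const n 1) (*-identityʳ n) ⟩
    n                    ≡⟨ order ⟩
    suc (Moore d k)      ∎)
    where open ≡-Reasoning

  outdeg≡d : ∀ u → outdeg G u ≡ d
  outdeg≡d u = ≤-antisym
    (+-cancelˡ-≤ (Moore d k) _ _ (subst (λ s → Moore d k + outdeg G u ≤ s + d) (rowSum≡Moore u)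
                                    (Moore+outdeg≤rowSum G outdeg≥d k≥1 u)))
    (outdeg≥d u)

  private
    indeg : Fin n → ℕ
    indeg x = Σ[ n ] (λ y → A y x)

    AW+AP≡d : ∀ u x → (A ⊗ W) u x + (A ⊗ P) u x ≡ d
    AW+AP≡d u x = begin
      (A ⊗ W) u x + (A ⊗ P) u x  ≡⟨ ⊗-distribˡ-+M A W P u x ⟨
      (A ⊗ (W +M P)) u x         ≡⟨ Σ-cong n (λ v → trans (cong (A u v *_) (W+P≡1 v x)) (*-identityʳ (A u v))) ⟩
      outdeg G u                 ≡⟨ outdeg≡d u ⟩
      d                          ∎
      where open ≡-Reasoning

    WA+PA≡indeg : ∀ u x → (W ⊗ A) u x + (P ⊗ A) u x ≡ indeg x
    WA+PA≡indeg u x = begin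
      (W ⊗ A) u x + (P ⊗ A) u x  ≡⟨ ⊗-distribʳ-+M A W P u x ⟨
      ((W +M P) ⊗ A) u x         ≡⟨ Σ-cong n (λ y → trans (cong (_* A y x) (W+P≡1 u y)) (*-identityˡ (A y x))) ⟩
      indeg x                    ∎
      where open ≡-Reasoning

    no-loops : Loopless G → ∀ v → A v v ≡ 0
    no-loops loopless v = cong b2n (loopless v)

  outlier-preserves-arcs : Loopless G → Injective _≡_ _≡_ o → Preserves o A
  outlier-preserves-arcs loopless o-injective u y =
    sym (+-cancelʳ-≡ d _ _ (trans (cong (A u y +_) (sym (indeg-o≡d y))) (balance u y)))
    where
    AP : ∀ u y → (A ⊗ P) u (o y) ≡ A u y
    AP u y = trans (Σ-cong n (λ v → cong (A u v *_) (idM-injective o-injective v y))) (Σ-δʳ n y (A u))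
    PA : ∀ u x → (P ⊗ A) u x ≡ A (o u) x
    PA u x = Σ-δˡ n (o u) (λ y → A y x)
    balance : ∀ u y → A u y + indeg (o y) ≡ A (o u) (o y) + d
    balance u y = begin
      A u y + indeg (o y)                                          ≡⟨ cong₂ _+_ (AP u y) (WA+PA≡indeg u (o y)) ⟨
      (A ⊗ P) u (o y) + ((W ⊗ A) u (o y) + (P ⊗ A) u (o y))        ≡⟨ cong (λ c → (A ⊗ P) u (o y) + (c + (P ⊗ A) u (o y))) (walksUpTo-comm G k u (o y)) ⟨
      (A ⊗ P) u (o y) + ((A ⊗ W) u (o y) + (P ⊗ A) u (o y))        ≡⟨ x∙yz≈yx∙z ((A ⊗ P) u (o y)) ((A ⊗ W) u (o y)) ((P ⊗ A) u (o y)) ⟩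
      (A ⊗ W) u (o y) + (A ⊗ P) u (o y) + (P ⊗ A) u (o y)          ≡⟨ cong₂ _+_ (AW+AP≡d u (o y)) (PA u (o y)) ⟩
      d + A (o u) (o y)                                            ≡⟨ +-comm d _ ⟩
      A (o u) (o y) + d                                            ∎
      where open ≡-Reasoning
    indeg-o≡d : ∀ y → indeg (o y) ≡ d
    indeg-o≡d y = trans (cong (_+ indeg (o y)) (sym (no-loops loopless y)))
                        (trans (balance y y) (cong (_+ d) (no-loops loopless (o y))))

b2n-∧ : ∀ a b → b2n (a ∧ b) ≡ b2n a * (if b then 1 else 0)
b2n-∧ true  true  = refl
b2n-∧ true  false = refl
b2n-∧ false b     = refl

tr-≤ : ∀ {n} (A : Mat n) {c} → (∀ i → A i i ≤ c) → tr A ≤ n * c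
tr-≤ {n} A Aii≤c = ≤-trans (Σ-mono-≤ n Aii≤c) (≤-reflexive (Σ-const n _))

tr-powSum1-≤ : ∀ {n} (A : Mat n) {c} m → (∀ ℓ → 1 ≤ ℓ → ℓ ≤ m → tr (A ^M ℓ) ≤ c) → tr (powSum1 A m) ≤ m * c
tr-powSum1-≤ {n} A zero    _    = ≤-reflexive (Σ-zero n)
tr-powSum1-≤ {n} A {c} (suc m) tr≤c = begin
  tr (powSum1 A (suc m))              ≡⟨ Σ-distrib-+ n _ _ ⟩
  tr (powSum1 A m) + tr (A ^M suc m)  ≤⟨ +-mono-≤ (tr-powSum1-≤ A m (λ ℓ 1≤ℓ ℓ≤m → tr≤c ℓ 1≤ℓ (m≤n⇒m≤1+n ℓ≤m)))
                                                  (tr≤c (suc m) (s≤s z≤n) ≤-refl) ⟩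
  m * c + c                           ≡⟨ +-comm (m * c) c ⟩
  suc m * c                           ∎
  where open ≤-Reasoning

module OrbitalConnection {d k n w : ℕ} {G : Digraph n} (k≥1 : 1 ≤ k) (loopless : Loopless G)
                         (geodetic : KGeodetic G k) (outdeg≥d : ∀ u → d ≤ outdeg G u) (order : n ≡ suc (Moore d k))
                         {o : Fin n → Fin n} (far : ∀ u → FarFrom G k u (o u))
                         {orb : Fin n → Fin w} (labelling : OrbitLabelling o orb)
                         (rep : Fin w → Fin n) (rep-orb : ∀ i → orb (rep i) ≡ i) where

  private
    A : Mat n
    A = adjMat G
    Ã : Mat w
    Ã = orbMat G orb rep

  o-automorphism : Preserves o A
  o-automorphism = outlier-preserves-arcs loopless (periodic⇒injective o (orbit-periodic labelling))
    where open Outlier k≥1 geodetic outdeg≥d order far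

  orbMat-equitable : ∀ x j → classSum orb A x j ≡ Ã (orb x) j
  orbMat-equitable x j = trans (classSum-orbit-invariant labelling o-automorphism (sym (rep-orb (orb x))) j)
                               (Σ-cong n (λ v → sym (b2n-∧ (G (rep (orb x)) v) _)))

  orbMat-^M-diag : ∀ ℓ i → (Ã ^M ℓ) i i ≡ classSum orb (A ^M ℓ) (rep i) (orb (rep i))
  orbMat-^M-diag ℓ i = begin
    (Ã ^M ℓ) i i                                ≡⟨ cong (λ j → (Ã ^M ℓ) j i) (rep-orb i) ⟨
    (Ã ^M ℓ) (orb (rep i)) i                    ≡⟨ classSum-^M orb A Ã orbMat-equitable ℓ (rep i) i ⟨
    classSum orb (A ^M ℓ) (rep i) i             ≡⟨ cong (classSum orb (A ^M ℓ) (rep i)) (rep-orb i) ⟨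
    classSum orb (A ^M ℓ) (rep i) (orb (rep i)) ∎
    where open ≡-Reasoning

  classSum-^M-diag-≤1 : ∀ ℓ → ℓ + ℓ ≤ k → ∀ u → classSum orb (A ^M ℓ) u (orb u) ≤ 1
  classSum-^M-diag-≤1 ℓ 2ℓ≤k = classSum-diag-≤1 labelling
    (^M-preserves (orbit-permutation labelling) o-automorphism ℓ)
    (λ u v → ≤-trans (^M≤walksUpTo G (≤-trans (m≤m+n ℓ ℓ) 2ℓ≤k) u v) (geodetic u v))
    (λ u z → ≤-trans (≤-reflexive (sym (^M-+ A ℓ ℓ u z))) (≤-trans (^M≤walksUpTo G 2ℓ≤k u z) (geodetic u z)))

  tr-orbMat-^M≤w : ∀ ℓ → ℓ + ℓ ≤ k → tr (Ã ^M ℓ) ≤ w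
  tr-orbMat-^M≤w ℓ 2ℓ≤k = subst (tr (Ã ^M ℓ) ≤_) (*-identityʳ w)
    (tr-≤ (Ã ^M ℓ) (λ i → subst (_≤ 1) (sym (orbMat-^M-diag ℓ i)) (classSum-^M-diag-≤1 ℓ 2ℓ≤k (rep i))))

half+half≤ : ∀ k → k / 2 + k / 2 ≤ k
half+half≤ k = subst (_≤ k) (trans (*-comm (k / 2) 2) (cong (k / 2 +_) (+-identityʳ (k / 2)))) (m/n*n≤m k 2)

mainTheorem7 : (d k n w : ℕ) → 2 ≤ d → 1 ≤ k → (G : Digraph n) → IsDK1 d k n G →
    (o : Fin n → Fin n) → (∀ u → FarFrom G k u (o u)) →
    (orb : Fin n → Fin w) → OrbitLabelling o orb →
    (rep : Fin w → Fin n) → (∀ i → orb (rep i) ≡ i) →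
    tr (powSum1 (orbMat G orb rep) (k / 2)) ≤ (k / 2) * w
mainTheorem7 d k n w _ k≥1 G (loopless , geodetic , outdeg≥d , order) o far orb labelling rep rep-orb =
  tr-powSum1-≤ (orbMat G orb rep) (k / 2) λ ℓ _ ℓ≤k/2 →
    tr-orbMat-^M≤w ℓ (≤-trans (+-mono-≤ ℓ≤k/2 ℓ≤k/2) (half+half≤ k))
  where open OrbitalConnection k≥1 loopless geodetic outdeg≥d order far labelling rep rep-orb
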